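{- Let $G$ be a connected strongly regular graph with parameters $(n,k,\lambda,\mu)$, with $k\geq 3$ and $\lambda\geq 2$. Then every vertex $u$ of $G$ is the central vertex of at least one wheel in $G$; that is, there is a cycle $C$ in $G$ (of some length $m\geq 3$) all of whose vertices are adjacent to $u$, so that $u$ together with $C$ and the edges from $u$ to the vertices of $C$ forms a subgraph of $G$ isomorphic to the wheel $W_m$ with centre $u$.
   Context: All graphs are finite and simple. A $k$-regular graph $G$ on $n$ vertices is strongly regular with parameters $(n,k,\lambda,\mu)$ if $G$ is neither complete nor empty, any two adjacent vertices have exactly $\lambda$ common neighbours, and any two non-adjacent vertices have exactly $\mu$ common neighbours. The wheel graph $W_m$ is obtained by joining a single new vertex (the central vertex) to all vertices of the cycle $C_m$. Subgraphs are not assumed to be induced. -}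

module Defs where

open import Data.Nat using (ℕ; suc; _≥_; _+_)
open import Data.Fin using (Fin)
open import Data.Fin.Properties using ()
open import Data.Bool using (Bool; true; false; _∧_; T)
open import Data.List using (List; []; _∷_; filter; length; allFin; lookup)
open import Data.Product using (Σ; ∃; _×_; _,_)
open import Relation.Binary.PropositionalEquality using (_≡_; _≢_)
open import Relation.Nullary using (¬_)
open import Data.Bool.Properties using (T?)
import Data.Nat as N

record Graph (n : ℕ) : Set where
  field
    adj    : Fin n → Fin n → Bool
    sym    : ∀ u v → adj u v ≡ adj v u
    irrefl : ∀ u → adj u u ≡ false
open Graph public

Adj : ∀ {n} → Graph n → Fin n → Fin n → Set
Adj G u v = T (adj G u v)

countV : ∀ {n} → (Fin n → Bool) → ℕ
countV {n} p = length (filter (λ w → T? (p w)) (allFin n))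

degree : ∀ {n} → Graph n → Fin n → ℕ
degree G u = countV (λ w → adj G u w)

commonNbrs : ∀ {n} → Graph n → Fin n → Fin n → ℕ
commonNbrs G u v = countV (λ w → adj G u w ∧ adj G v w)

record IsSRG {n : ℕ} (G : Graph n) (k l m : ℕ) : Set where
  field
    regular     : ∀ u → degree G u ≡ k
    notComplete : ∃ λ u → ∃ λ v → u ≢ v × ¬ Adj G u v
    notEmpty    : ∃ λ u → ∃ λ v → Adj G u v
    adjCommon   : ∀ u v → Adj G u v → commonNbrs G u v ≡ l
    nonAdjCommon : ∀ u v → u ≢ v → ¬ Adj G u v → commonNbrs G u v ≡ m

data Walk {n : ℕ} (G : Graph n) : Fin n → Fin n → Set where
  here : ∀ {u} → Walk G u u
  step : ∀ {u w v} → Adj G u w → Walk G w v → Walk G u v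

Connected : ∀ {n} → Graph n → Set
Connected G = ∀ u v → Walk G u v

-- A cycle C_m (m ≥ 3) in G: injective map c : Fin m → vertices with
-- c i adjacent to c (i+1 mod m).
sucMod : ∀ {m} → Fin m → Fin m
sucMod {suc m} i with Data.Fin.toℕ i N.<? m
... | Relation.Nullary.yes p = Data.Fin.fromℕ< (N.s≤s p)
... | Relation.Nullary.no _ = Data.Fin.zero

record Cycle {n : ℕ} (G : Graph n) (m : ℕ) : Set where
  field
    len≥3  : m ≥ 3
    vtx    : Fin m → Fin n
    inj    : ∀ i j → vtx i ≡ vtx j → i ≡ j
    edges  : ∀ i → Adj G (vtx i) (vtx (sucMod i))
open Cycle public

-- u is the central vertex of a wheel W_m in G: a cycle C of length m,
-- all of whose vertices are adjacent to u (hence distinct from u).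
HasWheelAt : ∀ {n} → Graph n → Fin n → Set
HasWheelAt G u = ∃ λ m → Σ (Cycle G m) λ C → ∀ i → Adj G u (vtx C i)

-- The neighbourhood of u induces a subgraph of minimum degree at least λ ≥ 2:
-- a neighbour y of u has λ common neighbours with u. In such a graph a
-- non-backtracking walk never gets stuck, and by the pigeonhole principle it
-- revisits a vertex; between the first repetition and the earlier visit it
-- traverses a cycle, of length at least 3 because the graph is loopless and the
-- walk does not backtrack. Every vertex of that cycle is adjacent to u.
module Submission where

open import Defs hiding (sym)
open import Data.Nat using (ℕ; zero; suc; _+_; _∸_; _<_; _≤_; _≥_; z≤n; s≤s; s≤s⁻¹; _<?_)
open import Data.Nat.Properties
  using (anyUpTo?; m≤n⇒m<n∨m≡n; m∸n+n≡m; m<n⇒0<n∸m; <⇒≤; +-cancelʳ-≡; +-monoˡ-<;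
         ≤-antisym; ≮⇒≥; n<1+n; ≤-trans; <-irrefl)
open import Data.Fin using (Fin; toℕ)
open import Data.Fin.Properties using (pigeonhole; toℕ-injective; toℕ<n; toℕ-fromℕ<; _≟_)
open import Data.Bool using (Bool; T; _∧_)
open import Data.Bool.Properties using (T?; T-∧)
open import Data.List using (List; _∷_; length; allFin)
open import Data.List.Relation.Unary.All using (All; []; _∷_)
open import Data.List.Relation.Unary.All.Properties using (all-filter)
open import Data.List.Relation.Unary.AllPairs using (_∷_)
open import Data.List.Relation.Unary.Unique.Propositional using (Unique)
import Data.List.Relation.Unary.Unique.Propositional.Properties as Unique
open import Data.Product using (Σ; ∃; _×_; _,_; proj₁; proj₂)
open import Data.Sum using (_⊎_; inj₁; inj₂)
open import Data.Empty using (⊥-elim)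
open import Function using (_∘_; Equivalence)
open import Relation.Binary.Definitions using (DecidableEquality)
open import Relation.Binary.PropositionalEquality using (_≡_; _≢_; refl; sym; trans; cong; subst)
open import Relation.Nullary using (¬_; yes; no)

module _ {a} {A : Set a} {P : A → Set} where

  All⇒∃ : ∀ {xs : List A} → All P xs → 1 ≤ length xs → ∃ P
  All⇒∃ (px ∷ _) _ = _ , px

  Unique∧All⇒∃≢ : DecidableEquality A → ∀ {xs : List A} → Unique xs → All P xs →
                  2 ≤ length xs → ∀ z → ∃ λ v → P v × v ≢ z
  Unique∧All⇒∃≢ _≟ₐ_ {x ∷ _ ∷ _} ((x≢y ∷ _) ∷ _) (px ∷ py ∷ _) _ z with x ≟ₐ z
  ... | yes refl = _ , py , x≢y ∘ sym
  ... | no x≢z   = _ , px , x≢z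
  Unique∧All⇒∃≢ _ _ (_ ∷ []) (s≤s ()) _

module _ {n} (p : Fin n → Bool) where

  countV-witness : 1 ≤ countV p → ∃ λ w → T (p w)
  countV-witness = All⇒∃ (all-filter (T? ∘ p) (allFin n))

  countV-witness-≢ : 2 ≤ countV p → ∀ z → ∃ λ w → T (p w) × w ≢ z
  countV-witness-≢ = Unique∧All⇒∃≢ _≟_
    (Unique.filter⁺ (T? ∘ p) (Unique.allFin⁺ n)) (all-filter (T? ∘ p) (allFin n))

module _ {a} {A : Set a} where

  InjectiveBelow : (ℕ → A) → ℕ → Set a
  InjectiveBelow f j = ∀ {b c} → b < j → c < j → f b ≡ f c → b ≡ c

  injectiveBelow-suc : ∀ {f j} → InjectiveBelow f j → (∀ {b} → b < j → f b ≢ f j) →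
                       InjectiveBelow f (suc j)
  injectiveBelow-suc inj new (s≤s b≤j) (s≤s c≤j) eq with m≤n⇒m<n∨m≡n b≤j | m≤n⇒m<n∨m≡n c≤j
  ... | inj₁ b<j  | inj₁ c<j  = inj b<j c<j eq
  ... | inj₁ b<j  | inj₂ refl = ⊥-elim (new b<j eq)
  ... | inj₂ refl | inj₁ c<j  = ⊥-elim (new c<j (sym eq))
  ... | inj₂ refl | inj₂ refl = refl

  record FirstRepetition (f : ℕ → A) : Set a where
    field
      start    : ℕ
      period   : ℕ
      positive : 0 < period
      closes   : f (period + start) ≡ f start
      fresh    : InjectiveBelow f (period + start)

  firstRepetition-or-injectiveBelow : DecidableEquality A → (f : ℕ → A) →
                                      ∀ j → FirstRepetition f ⊎ InjectiveBelow f j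
  firstRepetition-or-injectiveBelow _≟ₐ_ f zero = inj₂ λ ()
  firstRepetition-or-injectiveBelow _≟ₐ_ f (suc j)
    with firstRepetition-or-injectiveBelow _≟ₐ_ f j
  ... | inj₁ rep = inj₁ rep
  ... | inj₂ inj with anyUpTo? (λ b → f b ≟ₐ f j) j
  ...   | no new = inj₂ (injectiveBelow-suc inj λ b<j eq → new (_ , b<j , eq))
  ...   | yes (b , b<j , eq) = inj₁ record
    { start    = b
    ; period   = j ∸ b
    ; positive = m<n⇒0<n∸m b<j
    ; closes   = subst (λ k → f k ≡ f b) (sym j∸b+b≡j) (sym eq)
    ; fresh    = subst (InjectiveBelow f) (sym j∸b+b≡j) inj
    }
    where
    j∸b+b≡j : j ∸ b + b ≡ j
    j∸b+b≡j = m∸n+n≡m (<⇒≤ b<j)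

¬InjectiveBelow-suc : ∀ {n} (f : ℕ → Fin n) → ¬ InjectiveBelow f (suc n)
¬InjectiveBelow-suc {n} f inj with pigeonhole (n<1+n n) (f ∘ toℕ)
... | i , j , i<j , eq = <-irrefl (inj (toℕ<n i) (toℕ<n j) eq) i<j

firstRepetition : ∀ {n} (f : ℕ → Fin n) → FirstRepetition f
firstRepetition {n} f with firstRepetition-or-injectiveBelow _≟_ f (suc n)
... | inj₁ rep = rep
... | inj₂ inj = ⊥-elim (¬InjectiveBelow-suc f inj)

module _ {n} (G : Graph n) (w : ℕ → Fin n) (walk-adj : ∀ i → Adj G (w i) (w (suc i))) where

  sucMod-closes : ∀ {L i} → w (L + i) ≡ w i →
                  ∀ (t : Fin L) → w (suc (toℕ t) + i) ≡ w (toℕ (sucMod t) + i)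
  sucMod-closes {suc m} {i} closes t with toℕ t <? m
  ... | yes t<m = cong (λ k → w (k + i)) (sym (toℕ-fromℕ< (s≤s t<m)))
  ... | no  t≮m = trans (cong (λ k → w (suc k + i)) t≡m) closes
    where
    t≡m : toℕ t ≡ m
    t≡m = ≤-antisym (s≤s⁻¹ (toℕ<n t)) (≮⇒≥ t≮m)

  closedWalk⇒Cycle : ∀ {L} i → L ≥ 3 → w (L + i) ≡ w i → InjectiveBelow w (L + i) → Cycle G L
  closedWalk⇒Cycle i L≥3 closes inj = record
    { len≥3 = L≥3
    ; vtx   = λ t → w (toℕ t + i)
    ; inj   = λ t s eq →
        toℕ-injective (+-cancelʳ-≡ i _ _ (inj (+-monoˡ-< i (toℕ<n t)) (+-monoˡ-< i (toℕ<n s)) eq))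
    ; edges = λ t → subst (Adj G (w (toℕ t + i))) (sucMod-closes closes t) (walk-adj (toℕ t + i))
    }

  -- The period of a repetition counts its edges: 1 would be a loop, 2 a backtrack.
  nonBacktracking-period≥3 : (∀ i → w (suc (suc i)) ≢ w i) →
                             ∀ {p i} → 0 < p → w (p + i) ≡ w i → p ≥ 3
  nonBacktracking-period≥3 _  {suc zero} {i} _ closes =
    ⊥-elim (subst T (irrefl G (w i)) (subst (Adj G (w i)) closes (walk-adj i)))
  nonBacktracking-period≥3 nb {suc (suc zero)} _ closes = ⊥-elim (nb _ closes)
  nonBacktracking-period≥3 _  {suc (suc (suc _))} _ _ = s≤s (s≤s (s≤s z≤n))

CycleWithin : ∀ {n} → Graph n → (Fin n → Set) → Set
CycleWithin G S = ∃ λ m → Σ (Cycle G m) λ C → ∀ t → S (vtx C t)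

-- Minimum degree ≥ 2 inside S: whatever x is, y has a neighbour in S other than x.
TwoNeighboursWithin : ∀ {n} → Graph n → (Fin n → Set) → Set
TwoNeighboursWithin G S = ∀ {y} → S y → ∀ x → ∃ λ z → S z × Adj G y z × z ≢ x

module NonBacktrackingWalk {n} (G : Graph n) (S : Fin n → Set)
  (extend : TwoNeighboursWithin G S) {origin : Fin n} (s : S origin) where

  -- The previous vertex is kept so that the next step can avoid it.
  state : ℕ → Fin n × Σ (Fin n) S
  state zero    = origin , origin , s
  state (suc i) with state i
  ... | x , y , sy with extend sy x
  ...   | z , sz , _ = y , z , sz

  walk : ℕ → Fin n
  walk = proj₁ ∘ proj₂ ∘ state

  walk-within : ∀ i → S (walk i)
  walk-within = proj₂ ∘ proj₂ ∘ state

  walk-adj : ∀ i → Adj G (walk i) (walk (suc i))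
  walk-adj i with state i
  ... | x , y , sy with extend sy x
  ...   | _ , _ , y~z , _ = y~z

  walk-nonBacktracking : ∀ i → walk (suc (suc i)) ≢ walk i
  walk-nonBacktracking i with state i
  ... | x , y , sy with extend sy x
  ...   | z , sz , _ with extend sz y
  ...     | _ , _ , _ , z′≢y = z′≢y

  cycleWithin : CycleWithin G S
  cycleWithin = period , closedWalk⇒Cycle G walk walk-adj start period≥3 closes fresh
                       , λ t → walk-within (toℕ t + start)
    where
    open FirstRepetition (firstRepetition walk)
    period≥3 : period ≥ 3
    period≥3 = nonBacktracking-period≥3 G walk walk-adj walk-nonBacktracking positive closes

twoNeighboursWithin⇒CycleWithin : ∀ {n} (G : Graph n) (S : Fin n → Set) →
                                  TwoNeighboursWithin G S → ∃ S → CycleWithin G S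
twoNeighboursWithin⇒CycleWithin G S extend (_ , s) = NonBacktrackingWalk.cycleWithin G S extend s

lemma3 : (n k l m : ℕ) (G : Graph n) → IsSRG G k l m → Connected G →
         k ≥ 3 → l ≥ 2 → (u : Fin n) → HasWheelAt G u
lemma3 n k l m G srg _ k≥3 l≥2 u =
  twoNeighboursWithin⇒CycleWithin G (Adj G u) commonNeighbour neighbour
  where
  open IsSRG srg

  neighbour : ∃ (Adj G u)
  neighbour = countV-witness (adj G u) (subst (1 ≤_) (sym (regular u)) (≤-trans (s≤s z≤n) k≥3))

  commonNeighbour : TwoNeighboursWithin G (Adj G u)
  commonNeighbour {y} u~y x with countV-witness-≢ (λ z → adj G u z ∧ adj G y z)
                                   (subst (2 ≤_) (sym (adjCommon u y u~y)) l≥2) x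
  ... | z , both , z≢x = z , proj₁ (Equivalence.to T-∧ both) , proj₂ (Equivalence.to T-∧ both) , z≢x
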